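{- Let $h(x)=\sum_{i\ge1}h_ix^i\in\mathbb{K}[[x]]$ with $h_i\ne0$ for all $i\ge1$. Let $n$ be a positive integer, $y_0,y_1,\dots,y_{n-1}\in\mathbb{K}$, and let $G:\mathbb{K}[[x]]\to\mathbb{K}[[x]]$ satisfy $d(G(f),G(g))\le 2^{n-1}d(f,g)$ for all $f,g$. Then the initial value problem $$\mathcal{D}_h^{(n)}(y)=G(y),\quad y(0)=y_0,\ \mathcal{D}_h(y)(0)=y_1,\ \dots,\ \mathcal{D}_h^{(n-1)}(y)(0)=y_{n-1}$$ has a unique solution, which is the unique fixed point of the contractive function $$F(f)=y_0+\frac{y_1}{h_1}x+\frac{y_2}{h_2h_1}x^2+\cdots+\frac{y_{n-1}}{h_{n-1}h_{n-2}\cdots h_1}x^{n-1}+\mathcal{I}_h^{(n)}(G(f)),\qquad f\in\mathbb{K}[[x]].$$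
   Context: $\mathbb{K}$ is a field of characteristic zero. On $\mathbb{K}[[x]]$, $\omega(s)$ is the order of a series (index of its first nonzero coefficient) and $d(f,g)=2^{ -\omega(f-g)}$ (with $d(f,f)=0$). The $h$-derivative is $\mathcal{D}_h\big(\sum_{k\ge0}s_kx^k\big)=\sum_{k\ge1}h_ks_kx^{k-1}$ and the $h$-integral is $\mathcal{I}_h\big(\sum_{k\ge0}s_kx^k\big)=\sum_{k\ge0}\frac{s_k}{h_{k+1}}x^{k+1}$; $\mathcal{D}_h^{(n)}$, $\mathcal{I}_h^{(n)}$ denote $n$-fold compositions. $g(0)$ denotes the constant term of $g$. A function is contractive if it is $c$-Lipschitz for $d$ with some $c\in[0,1)$. -}

module Defs where

open import Level using (Level; _⊔_; suc)
open import Algebra.Bundles using (CommutativeRing)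
open import Data.Nat as ℕ using (ℕ; zero; _<_; _≤_; _<?_)
import Data.Nat
open import Data.Fin using (Fin; fromℕ<)
open import Data.Product using (Σ; _×_; ∃)
open import Relation.Nullary using (¬_; yes; no)

-- A field (classical, with a total inverse: 0⁻¹ is an arbitrary value),
-- on a setoid carrier, as a commutative ring with inverses of nonzero elements.
record Field (c ℓ : Level) : Set (Level.suc (c ⊔ ℓ)) where
  field
    commutativeRing : CommutativeRing c ℓ
  open CommutativeRing commutativeRing public
  field
    _⁻¹      : Carrier → Carrier
    ⁻¹-cong  : ∀ {x y} → x ≈ y → x ⁻¹ ≈ y ⁻¹
    ⁻¹-inverse : ∀ x → ¬ (x ≈ 0#) → (x * x ⁻¹) ≈ 1#
    1≉0      : ¬ (1# ≈ 0#)

module _ {c ℓ} (K : Field c ℓ) where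
  open Field K

  natCast : ℕ → Carrier
  natCast zero = 0#
  natCast (ℕ.suc n) = 1# + natCast n

  CharZero : Set ℓ
  CharZero = ∀ n → ¬ (natCast (ℕ.suc n) ≈ 0#)

  Series : Set c
  Series = ℕ → Carrier

  _≋_ : Series → Series → Set ℓ
  f ≋ g = ∀ k → f k ≈ g k

  -- f and g agree on all coefficients of index < m, i.e. d(f,g) ≤ 2^(-m)
  -- (ω(f - g) ≥ m, with ω = ∞ when f = g).
  AgreeBelow : ℕ → Series → Series → Set ℓ
  AgreeBelow m f g = ∀ k → k < m → f k ≈ g k

  -- d(F f, F g) ≤ 2^(up - down) · d(f, g) for all f g
  -- (encoded: d(f,g) ≤ 2^(-(m+up)) implies d(Ff,Fg) ≤ 2^(-(m+down)) for all m).
  -- Since d(f,g) = 2^(-ω(f-g)) (or 0), this is exactly the Lipschitz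
  -- condition with constant 2^(up - down).
  Lipschitz2^ : (up down : ℕ) → (Series → Series) → Set (c ⊔ ℓ)
  Lipschitz2^ up down F =
    ∀ f g m → AgreeBelow (m ℕ.+ up) f g → AgreeBelow (m ℕ.+ down) (F f) (F g)

  -- contractive: c-Lipschitz for some c ∈ [0,1). Since d takes values in
  -- {0} ∪ {2^(-k)}, this is equivalent to being 2^(-e)-Lipschitz for some e ≥ 1.
  Contractive : (Series → Series) → Set (c ⊔ ℓ)
  Contractive F = Σ ℕ λ e → (1 ≤ e) × Lipschitz2^ 0 e F

  Dh : Series → Series → Series
  Dh h s k = h (ℕ.suc k) * s (ℕ.suc k)

  Ih : Series → Series → Series
  Ih h s zero = 0#
  Ih h s (ℕ.suc k) = s k * (h (ℕ.suc k)) ⁻¹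

  iterate : ℕ → (Series → Series) → Series → Series
  iterate zero T s = s
  iterate (ℕ.suc n) T s = T (iterate n T s)

  Dh^ : ℕ → Series → Series → Series
  Dh^ n h = iterate n (Dh h)

  Ih^ : ℕ → Series → Series → Series
  Ih^ n h = iterate n (Ih h)

  hProd : Series → ℕ → Carrier
  hProd h zero = 1#
  hProd h (ℕ.suc k) = h (ℕ.suc k) * hProd h k

  initPoly : (n : ℕ) → Series → (Fin n → Carrier) → Series
  initPoly n h ys k with k <? n
  ... | yes k<n = ys (fromℕ< k<n) * (hProd h k) ⁻¹
  ... | no _ = 0#

  _⊕_ : Series → Series → Series
  (f ⊕ g) k = f k + g k

  fixedPointMap : (n : ℕ) → Series → (Fin n → Carrier) → (Series → Series) → Series → Series
  fixedPointMap n h ys G f = initPoly n h ys ⊕ Ih^ n h (G f)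

  SolvesIVP : (n : ℕ) → Series → (Fin n → Carrier) → (Series → Series) → Series → Set ℓ
  SolvesIVP n h ys G y =
    (Dh^ n h y ≋ G y) × (∀ (i : Fin n) → Dh^ (Data.Fin.toℕ i) h y 0 ≈ ys i)

  IsFixedPoint : (Series → Series) → Series → Set ℓ
  IsFixedPoint F y = F y ≋ y

{-# OPTIONS --safe #-}
module Submission where

-- Coefficientwise, D_h^(n) shifts a series down by n places and multiplies
-- the coefficients by products of the h_i, while I_h^(n) shifts up by n
-- places and divides by the same products.  Hence y solves the initial value
-- problem iff y = F(y): below degree n both say that the coefficients of y
-- are the rescaled initial values, from degree n on both are the equation.
-- Since I_h^(n) raises the order by n and G lowers it by at most n - 1, F is
-- ½-Lipschitz for the x-adic metric, so the iterates F^m(0) stabilise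
-- coefficient by coefficient to the unique fixed point.

open import Defs
open import Level using (Level)
open import Data.Nat using (ℕ; zero; suc; _+_; _≤_; _<_; _∸_; _<?_; z≤n; s≤s; z<s; s<s)
import Data.Nat.Properties as ℕ
open import Data.Fin using (Fin; toℕ; fromℕ<)
open import Data.Fin.Properties using (toℕ<n; fromℕ<-toℕ; toℕ-fromℕ<)
open import Data.Product using (Σ; _×_; _,_)
open import Data.Sum using (inj₁; inj₂)
open import Data.Empty using (⊥-elim)
open import Function using (_∘_)
open import Relation.Nullary using (¬_; yes; no)
open import Relation.Binary.PropositionalEquality as ≡ using (_≡_)

data BelowOrFrom (n : ℕ) : ℕ → Set where
  below : ∀ {k} → k < n → BelowOrFrom n k
  from  : ∀ j → BelowOrFrom n (n + j)

belowOrFrom : ∀ n k → BelowOrFrom n k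
belowOrFrom zero    k       = from k
belowOrFrom (suc n) zero    = below z<s
belowOrFrom (suc n) (suc k) with belowOrFrom n k
... | below k<n = below (s<s k<n)
... | from j    = from j

m<n⇒1+o+m≤n+o : ∀ {m n o} → m < n → suc o + m ≤ n + o
m<n⇒1+o+m≤n+o {m} {n} {o} m<n = begin
  suc o + m   ≡⟨ ℕ.+-suc o m ⟨
  o + suc m   ≤⟨ ℕ.+-monoʳ-≤ o m<n ⟩
  o + n       ≡⟨ ℕ.+-comm o n ⟩
  n + o       ∎
  where open ℕ.≤-Reasoning

module _ {c ℓ} (K : Field c ℓ) where
  open Field K hiding (zero; _+_)
  open import Relation.Binary.Reasoning.Setoid setoid
  open import Algebra.Properties.CommutativeSemigroup *-commutativeSemigroup
    using (x∙yz≈y∙xz; xy∙z≈y∙xz; interchange)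

  inverse-cancelˡ : ∀ {x y} a → x * y ≈ 1# → x * (a * y) ≈ a
  inverse-cancelˡ {x} {y} a xy≈1 = begin
    x * (a * y) ≈⟨ x∙yz≈y∙xz x a y ⟩
    a * (x * y) ≈⟨ *-congˡ xy≈1 ⟩
    a * 1#      ≈⟨ *-identityʳ a ⟩
    a           ∎

  inverse-cancelʳ : ∀ {x y} a → x * y ≈ 1# → (x * a) * y ≈ a
  inverse-cancelʳ {x} {y} a xy≈1 =
    trans (xy∙z≈y∙xz x a y) (trans (*-congˡ xy≈1) (*-identityʳ a))

  *-nonzero : ∀ {x y} → ¬ x ≈ 0# → ¬ y ≈ 0# → ¬ x * y ≈ 0#
  *-nonzero {x} {y} x≉0 y≉0 xy≈0 = y≉0 (begin
    y               ≈⟨ sym (inverse-cancelʳ y (⁻¹-inverse x x≉0)) ⟩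
    (x * y) * x ⁻¹  ≈⟨ *-congʳ xy≈0 ⟩
    0# * x ⁻¹       ≈⟨ zeroˡ (x ⁻¹) ⟩
    0#              ∎)

  -- rangeProd u n k = u (k + 1) ⋯ u (k + n)
  rangeProd : (ℕ → Carrier) → ℕ → ℕ → Carrier
  rangeProd u zero    k = 1#
  rangeProd u (suc n) k = rangeProd u n k * u (suc (n + k))

  rangeProd-inverse : ∀ {u v} → (∀ i → u (suc i) * v (suc i) ≈ 1#) →
                      ∀ n k → rangeProd u n k * rangeProd v n k ≈ 1#
  rangeProd-inverse uv≈1 zero    k = *-identityˡ 1#
  rangeProd-inverse {u} {v} uv≈1 (suc n) k = begin
    (rangeProd u n k * u (suc (n + k))) * (rangeProd v n k * v (suc (n + k)))
      ≈⟨ interchange _ _ _ _ ⟩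
    (rangeProd u n k * rangeProd v n k) * (u (suc (n + k)) * v (suc (n + k)))
      ≈⟨ *-cong (rangeProd-inverse uv≈1 n k) (uv≈1 (n + k)) ⟩
    1# * 1#
      ≈⟨ *-identityˡ 1# ⟩
    1# ∎

  rangeProd-0≈hProd : ∀ u n → rangeProd u n 0 ≈ hProd K u n
  rangeProd-0≈hProd u zero    = refl
  rangeProd-0≈hProd u (suc n) = begin
    rangeProd u n 0 * u (suc (n + 0)) ≈⟨ *-comm _ _ ⟩
    u (suc (n + 0)) * rangeProd u n 0 ≡⟨ ≡.cong (λ i → u (suc i) * rangeProd u n 0) (ℕ.+-identityʳ n) ⟩
    u (suc n) * rangeProd u n 0       ≈⟨ *-congˡ (rangeProd-0≈hProd u n) ⟩
    u (suc n) * hProd K u n           ∎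

  hProd-nonzero : ∀ {h} → (∀ i → ¬ h (suc i) ≈ 0#) → ∀ k → ¬ hProd K h k ≈ 0#
  hProd-nonzero h≉0 zero    = 1≉0
  hProd-nonzero h≉0 (suc k) = *-nonzero (h≉0 k) (hProd-nonzero h≉0 k)

  iterate-suc : ∀ n (T : Series K → Series K) s → iterate K (suc n) T s ≡ iterate K n T (T s)
  iterate-suc zero    T s = ≡.refl
  iterate-suc (suc n) T s = ≡.cong T (iterate-suc n T s)

  AgreeBelow-weaken : ∀ {m m′ f g} → m ≤ m′ → AgreeBelow K m′ f g → AgreeBelow K m f g
  AgreeBelow-weaken m≤m′ agree k k<m = agree k (ℕ.≤-trans k<m m≤m′)

  Lipschitz½ : (Series K → Series K) → Set (c Level.⊔ ℓ)
  Lipschitz½ F = ∀ f g m → AgreeBelow K m f g → AgreeBelow K (suc m) (F f) (F g)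

  Lipschitz½⇒Contractive : ∀ {F} → Lipschitz½ F → Contractive K F
  Lipschitz½⇒Contractive F-½ = 1 , s≤s z≤n , λ f g m agree →
    AgreeBelow-weaken (ℕ.≤-reflexive (ℕ.+-comm m 1))
      (F-½ f g m (AgreeBelow-weaken (ℕ.m≤m+n m 0) agree))

  module _ {F : Series K → Series K} (F-½ : Lipschitz½ F) where

    iterates-agree : ∀ m s t → AgreeBelow K m (iterate K m F s) (iterate K m F t)
    iterates-agree zero    s t k ()
    iterates-agree (suc m) s t = F-½ _ _ m (iterates-agree m s t)

    limit : Series K
    limit k = iterate K (suc k) F (λ _ → 0#) k

    limit-agrees-iterate : ∀ m s → AgreeBelow K m limit (iterate K m F s)
    limit-agrees-iterate zero    s k ()
    limit-agrees-iterate (suc m) s k k<1+m with ℕ.m<1+n⇒m<n∨m≡n k<1+m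
    ... | inj₁ k<m = begin
      limit k                    ≈⟨ limit-agrees-iterate m (F s) k k<m ⟩
      iterate K m F (F s) k      ≡⟨ ≡.cong-app (iterate-suc m F s) k ⟨
      iterate K (suc m) F s k    ∎
    ... | inj₂ ≡.refl = iterates-agree (suc m) _ s m (ℕ.n<1+n m)

    limit-fixed : IsFixedPoint K F limit
    limit-fixed k = F-½ _ _ k (limit-agrees-iterate k (λ _ → 0#)) k (ℕ.n<1+n k)

    fixedPoints-agree : ∀ {y z} → IsFixedPoint K F y → IsFixedPoint K F z →
                        ∀ m → AgreeBelow K m z y
    fixedPoints-agree y-fixed z-fixed zero k ()
    fixedPoints-agree {y} {z} y-fixed z-fixed (suc m) k k<1+m = begin
      z k    ≈⟨ sym (z-fixed k) ⟩
      F z k  ≈⟨ F-½ z y m (fixedPoints-agree y-fixed z-fixed m) k k<1+m ⟩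
      F y k  ≈⟨ y-fixed k ⟩
      y k    ∎

  Lipschitz½⇒uniqueFixedPoint : ∀ {F} → Lipschitz½ F →
    Σ (Series K) λ y → IsFixedPoint K F y × (∀ z → IsFixedPoint K F z → _≋_ K z y)
  Lipschitz½⇒uniqueFixedPoint F-½ = limit F-½ , limit-fixed F-½ , λ z z-fixed k →
    fixedPoints-agree F-½ (limit-fixed F-½) z-fixed (suc k) k (ℕ.n<1+n k)

module _ {c ℓ} (K : Field c ℓ) (h : Series K) where
  open Field K hiding (zero; _+_)
  open import Relation.Binary.Reasoning.Setoid setoid

  private
    h⁻¹ : Series K
    h⁻¹ i = h i ⁻¹

  Dh^-coeff : ∀ n f k → Dh^ K n h f k ≈ rangeProd K h n k * f (n + k)
  Dh^-coeff zero    f k = sym (*-identityˡ (f k))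
  Dh^-coeff (suc n) f k = begin
    Dh^ K (suc n) h f k
      ≡⟨ ≡.cong-app (iterate-suc K n (Dh K h) f) k ⟩
    Dh^ K n h (Dh K h f) k
      ≈⟨ Dh^-coeff n (Dh K h f) k ⟩
    rangeProd K h n k * (h (suc (n + k)) * f (suc (n + k)))
      ≈⟨ sym (*-assoc _ _ _) ⟩
    rangeProd K h (suc n) k * f (suc n + k) ∎

  Dh^-at-0 : ∀ k f → Dh^ K k h f 0 ≈ hProd K h k * f k
  Dh^-at-0 k f = trans (Dh^-coeff k f 0)
    (*-cong (rangeProd-0≈hProd K h k) (reflexive (≡.cong f (ℕ.+-identityʳ k))))

  Ih^-below : ∀ n s {k} → k < n → Ih^ K n h s k ≈ 0#
  Ih^-below (suc n) s {zero}  _           = refl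
  Ih^-below (suc n) s {suc k} (s<s k<n) = trans (*-congʳ (Ih^-below n s k<n)) (zeroˡ _)

  Ih^-from : ∀ n s j → Ih^ K n h s (n + j) ≈ s j * rangeProd K h⁻¹ n j
  Ih^-from zero    s j = sym (*-identityʳ (s j))
  Ih^-from (suc n) s j = trans (*-congʳ (Ih^-from n s j)) (*-assoc _ _ _)

  initPoly-below : ∀ n ys {k} (k<n : k < n) → initPoly K n h ys k ≈ ys (fromℕ< k<n) * hProd K h k ⁻¹
  initPoly-below n ys {k} k<n with k <? n
  ... | yes _   = refl
  ... | no k≮n = ⊥-elim (k≮n k<n)

  initPoly-from : ∀ n ys j → initPoly K n h ys (n + j) ≈ 0#
  initPoly-from n ys j with n + j <? n
  ... | yes n+j<n = ⊥-elim (ℕ.m+n≮m n j n+j<n)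
  ... | no _      = refl

  module _ (n : ℕ) (ys : Fin n → Carrier) (G : Series K → Series K) where

    private
      F : Series K → Series K
      F = fixedPointMap K n h ys G

    fixedPointMap-below : ∀ f {k} (k<n : k < n) → F f k ≈ ys (fromℕ< k<n) * hProd K h k ⁻¹
    fixedPointMap-below f k<n =
      trans (+-cong (initPoly-below n ys k<n) (Ih^-below n (G f) k<n)) (+-identityʳ _)

    fixedPointMap-from : ∀ f j → F f (n + j) ≈ G f j * rangeProd K h⁻¹ n j
    fixedPointMap-from f j =
      trans (+-cong (initPoly-from n ys j) (Ih^-from n (G f) j)) (+-identityˡ _)

    fixedPointMap-Lipschitz½ : ∀ {up} → up < n → Lipschitz2^ K up 0 G → Lipschitz½ K F
    fixedPointMap-Lipschitz½ {up} up<n G-lip f g m agree k k<1+m with belowOrFrom n k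
    ... | below k<n = trans (fixedPointMap-below f k<n) (sym (fixedPointMap-below g k<n))
    ... | from j    = begin
      F f (n + j)                  ≈⟨ fixedPointMap-from f j ⟩
      G f j * rangeProd K h⁻¹ n j  ≈⟨ *-congʳ (G-lip f g (suc j) (AgreeBelow-weaken K j+1+up≤m agree) j j<j+1) ⟩
      G g j * rangeProd K h⁻¹ n j  ≈⟨ fixedPointMap-from g j ⟨
      F g (n + j)                  ∎
      where
      j<j+1 : j < suc j + 0
      j<j+1 = s≤s (ℕ.m≤m+n j 0)

      j+1+up≤m : suc j + up ≤ m
      j+1+up≤m = ℕ.≤-trans (m<n⇒1+o+m≤n+o up<n) (ℕ.≤-pred k<1+m)

    module _ (h≉0 : ∀ i → ¬ h (suc i) ≈ 0#) where

      private
        hProd-invertible : ∀ k → hProd K h k * hProd K h k ⁻¹ ≈ 1#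
        hProd-invertible k = ⁻¹-inverse _ (hProd-nonzero K h≉0 k)

        rangeProd-invertible : ∀ j → rangeProd K h n j * rangeProd K h⁻¹ n j ≈ 1#
        rangeProd-invertible = rangeProd-inverse K (λ i → ⁻¹-inverse _ (h≉0 i)) n

      fixedPoint⇒solvesIVP : ∀ y → IsFixedPoint K F y → SolvesIVP K n h ys G y
      fixedPoint⇒solvesIVP y y-fixed = equation , initial
        where
        equation : _≋_ K (Dh^ K n h y) (G y)
        equation j = begin
          Dh^ K n h y j                                           ≈⟨ Dh^-coeff n y j ⟩
          rangeProd K h n j * y (n + j)                           ≈⟨ *-congˡ (y-fixed (n + j)) ⟨
          rangeProd K h n j * F y (n + j)                         ≈⟨ *-congˡ (fixedPointMap-from y j) ⟩
          rangeProd K h n j * (G y j * rangeProd K h⁻¹ n j)       ≈⟨ inverse-cancelˡ K (G y j) (rangeProd-invertible j) ⟩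
          G y j                                                   ∎

        initial : ∀ i → Dh^ K (toℕ i) h y 0 ≈ ys i
        initial i = begin
          Dh^ K k h y 0                                          ≈⟨ Dh^-at-0 k y ⟩
          hProd K h k * y k                                      ≈⟨ *-congˡ (y-fixed k) ⟨
          hProd K h k * F y k                                    ≈⟨ *-congˡ (fixedPointMap-below y (toℕ<n i)) ⟩
          hProd K h k * (ys (fromℕ< (toℕ<n i)) * hProd K h k ⁻¹) ≈⟨ inverse-cancelˡ K _ (hProd-invertible k) ⟩
          ys (fromℕ< (toℕ<n i))                                  ≡⟨ ≡.cong ys (fromℕ<-toℕ i (toℕ<n i)) ⟩
          ys i                                                   ∎
          where k = toℕ i

      solvesIVP⇒fixedPoint : ∀ z → SolvesIVP K n h ys G z → IsFixedPoint K F z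
      solvesIVP⇒fixedPoint z (equation , initial) k with belowOrFrom n k
      ... | below k<n = begin
        F z k
          ≈⟨ fixedPointMap-below z k<n ⟩
        ys (fromℕ< k<n) * hProd K h k ⁻¹
          ≈⟨ *-congʳ (initial (fromℕ< k<n)) ⟨
        Dh^ K (toℕ (fromℕ< k<n)) h z 0 * hProd K h k ⁻¹
          ≡⟨ ≡.cong (λ t → Dh^ K t h z 0 * hProd K h k ⁻¹) (toℕ-fromℕ< k<n) ⟩
        Dh^ K k h z 0 * hProd K h k ⁻¹
          ≈⟨ *-congʳ (Dh^-at-0 k z) ⟩
        (hProd K h k * z k) * hProd K h k ⁻¹
          ≈⟨ inverse-cancelʳ K (z k) (hProd-invertible k) ⟩
        z k ∎
      ... | from j = begin
        F z (n + j)
          ≈⟨ fixedPointMap-from z j ⟩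
        G z j * rangeProd K h⁻¹ n j
          ≈⟨ *-congʳ (equation j) ⟨
        Dh^ K n h z j * rangeProd K h⁻¹ n j
          ≈⟨ *-congʳ (Dh^-coeff n z j) ⟩
        (rangeProd K h n j * z (n + j)) * rangeProd K h⁻¹ n j
          ≈⟨ inverse-cancelʳ K (z (n + j)) (rangeProd-invertible j) ⟩
        z (n + j) ∎

mainTheorem3 : ∀ {c ℓ : Level} (K : Field c ℓ) → CharZero K →
    (h : Series K) → Field._≈_ K (h 0) (Field.0# K) →
    (∀ i → ¬ Field._≈_ K (h (suc i)) (Field.0# K)) →
    (n : ℕ) → 1 ≤ n → (ys : Fin n → Field.Carrier K) →
    (G : Series K → Series K) → Lipschitz2^ K (n ∸ 1) 0 G →
    Σ (Series K) λ y →
      SolvesIVP K n h ys G y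
      × (∀ z → SolvesIVP K n h ys G z → _≋_ K z y)
      × Contractive K (fixedPointMap K n h ys G)
      × IsFixedPoint K (fixedPointMap K n h ys G) y
      × (∀ z → IsFixedPoint K (fixedPointMap K n h ys G) z → _≋_ K z y)
mainTheorem3 K _ h _ h≉0 n 1≤n ys G G-lip =
  let y , y-fixed , y-unique = Lipschitz½⇒uniqueFixedPoint K F-½
  in  y , fixedPoint⇒solvesIVP K h n ys G h≉0 y y-fixed
        , (λ z → y-unique z ∘ solvesIVP⇒fixedPoint K h n ys G h≉0 z)
        , Lipschitz½⇒Contractive K F-½ , y-fixed , y-unique
  where
  F-½ : Lipschitz½ K (fixedPointMap K n h ys G)
  F-½ = fixedPointMap-Lipschitz½ K h n ys G (ℕ.∸-monoʳ-< z<s 1≤n) G-lip
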